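{- Let $k\ge1$ and let $\sigma$ be a $k$-permutation. (1) If $\sigma$ is fully $k$-rooted cuttable, then $\sigma$ contains no pattern $b_1\cdots b_k\cdot c\cdot a$ with $a\le b_i\le c$ for all $i\in[k]$. (2) If $\sigma$ is not fully $k$-rooted cuttable, then $\sigma$ contains a pattern $a_1\cdots a_k\cdot b\cdot a$ with $a<b$ and $a_i\le b$ for all $i\in[k]$, and a pattern $b_1\cdots b_k\cdot b\cdot a$ with $a<b$ and $a\le b_i$ for all $i\in[k]$.
   Context: A $k$-permutation of degree $n$ is a word on the multiset $\{1^k,\dots,n^k\}$. A $k$-permutation $\sigma$ contains a pattern $x_1\cdots x_r$ (with stated inequalities) if there are positions $p_1<\dots<p_r$ such that the letters $\sigma_{p_1},\dots,\sigma_{p_r}$, named $x_1,\dots,x_r$, satisfy those inequalities. For $\gamma\in[n-1]$, $\gamma$ is a $k$-rooted cut of $\sigma$ if $\sigma=\alpha\beta\delta$ with $|\alpha|=k$, all letters of $\beta$ at most $\gamma$ and all letters of $\delta$ greater than $\gamma$; $\sigma$ is $k$-rooted cuttable if it has one. For $L=\{\ell_1<\dots<\ell_q\}\subseteq[n]$, $\sigma^{|L}$ keeps the letters in $L$ and replaces $\ell_x$ by $x$. $\sigma$ is fully $k$-rooted cuttable if $\sigma^{|[a,b]}$ is $k$-rooted cuttable for every interval $[a,b]\subseteq[n]$ with $a<b$. -}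

module Defs where

open import Data.Nat using (ℕ; zero; suc; _+_; _∸_; _≤_; _<_; _≤?_; _≟_)
open import Data.Fin as F using (Fin; _↑ˡ_; _↑ʳ_)
open import Data.List using (List; length; lookup; _++_; filter; map)
open import Data.List.Relation.Unary.All using (All)
open import Data.Product using (Σ; ∃; _×_; _,_)
open import Relation.Nullary.Decidable using (_×-dec_)
open import Relation.Binary.PropositionalEquality using (_≡_)

IsKPerm : ℕ → ℕ → List ℕ → Set
IsKPerm k n σ =
  All (λ x → 1 ≤ x × x ≤ n) σ ×
  (∀ i → 1 ≤ i → i ≤ n → length (filter (_≟ i) σ) ≡ k)

StrictlyIncreasing : ∀ {r m} → (Fin r → Fin m) → Set
StrictlyIncreasing {r} f = ∀ (i j : Fin r) → i F.< j → f i F.< f j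

Contains : (σ : List ℕ) (r : ℕ) → ((Fin r → ℕ) → Set) → Set
Contains σ r P =
  Σ (Fin r → Fin (length σ)) λ p →
    StrictlyIncreasing p × P (λ i → lookup σ (p i))

ContainsRooted : (k : ℕ) (σ : List ℕ) → ((Fin k → ℕ) → ℕ → ℕ → Set) → Set
ContainsRooted k σ R =
  Contains σ (k + 2) λ w →
    R (λ i → w (i ↑ˡ 2)) (w (k ↑ʳ F.zero)) (w (k ↑ʳ F.suc F.zero))

IsKRootedCut : ℕ → ℕ → List ℕ → ℕ → Set
IsKRootedCut k n σ γ =
  1 ≤ γ × γ < n ×
  Σ (List ℕ) λ α → Σ (List ℕ) λ β → Σ (List ℕ) λ δ →
    σ ≡ α ++ β ++ δ × length α ≡ k × All (_≤ γ) β × All (γ <_) δ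

KRootedCuttable : ℕ → ℕ → List ℕ → Set
KRootedCuttable k n σ = ∃ λ γ → IsKRootedCut k n σ γ

-- σ^{|[a,b]}: keep the letters in [a,b] and replace the x-th smallest element
-- ℓ_x = a + x - 1 of [a,b] by x (i.e. ℓ ↦ ℓ - a + 1). Its degree is b - a + 1.
restrictInterval : ℕ → ℕ → List ℕ → List ℕ
restrictInterval a b σ =
  map (λ x → suc (x ∸ a)) (filter (λ x → (a ≤? x) ×-dec (x ≤? b)) σ)

FullyKRootedCuttable : ℕ → ℕ → List ℕ → Set
FullyKRootedCuttable k n σ =
  ∀ a b → 1 ≤ a → a < b → b ≤ n →
    KRootedCuttable k (suc (b ∸ a)) (restrictInterval a b σ)

-- Both parts rest on one observation: if γ is a k-rooted cut of a word τ, then after the first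
-- k letters of τ no letter greater than γ is ever followed by a letter at most γ.
--
-- (1) Given b₁⋯b_k c a with a ≤ bᵢ ≤ c, the case a = c is excluded because the letter a would
-- occur k + 2 times. Otherwise restrict σ to [a, c]: the pattern survives as k letters followed by
-- the rescaled c = c − a + 1 and a = 1, and any cut 1 ≤ γ ≤ c − a of the restriction separates
-- them in the wrong order.
--
-- (2) Every interval [a, b] with a < b contains the k copies of a, so its restriction starts with k
-- letters a₁⋯a_k (all in [a, b]) followed by a rest ρ. If ρ has no letter ≥ b before a letter
-- ≤ b − 1, then b − a is a cut; if ρ has no letter > a before a letter ≤ a, then 1 is a cut. So an
-- interval without a cut yields both patterns. The interval is found constructively by searching
-- the finitely many intervals of [1, n].
module Submission where

open import Defs
open import Data.Nat using (ℕ; zero; suc; _+_; _∸_; _≤_; _<_; z≤n; s≤s; s≤s⁻¹; _≤?_; _<?_; _≟_)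
open import Data.Nat.Properties
open import Data.Fin using (Fin; zero; suc; toℕ; fromℕ<; _↑ˡ_; _↑ʳ_)
open import Data.List using (List; []; _∷_; _++_; map; filter; length; lookup; tabulate; drop)
open import Data.List.Properties
  using (map-++; map-tabulate; length-++; length-map; length-tabulate; tabulate-cong; filter-all)
open import Data.List.Relation.Unary.All as All using (All; []; _∷_)
import Data.List.Relation.Unary.All.Properties as Allₚ
open import Data.List.Relation.Binary.Sublist.Propositional using (_⊆_; []; _∷_; _∷ʳ_; ⊆-refl; ⊆-trans; minimum)
open import Data.List.Relation.Binary.Sublist.Propositional.Properties
  using (map⁺; filter⁺; filter-⊆; ++⁺; ++⁻; length-mono-≤; All-resp-⊆)
import Data.Vec.Functional as Vector
open import Data.Vec.Functional.Properties using (lookup-++ˡ; lookup-++ʳ)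
open import Data.Product using (Σ; ∃₂; _×_; _,_; proj₁; proj₂)
open import Data.Sum using (_⊎_; inj₁; inj₂; [_,_]′; map₁)
open import Data.Empty using (⊥-elim)
open import Function using (_∘_; id)
open import Level using (0ℓ)
open import Relation.Nullary using (¬_; yes; no)
open import Relation.Nullary.Decidable using (_×-dec_)
open import Relation.Unary using (Pred; Decidable)
open import Relation.Binary.PropositionalEquality
  using (_≡_; _≗_; refl; sym; trans; cong; cong₂; subst; subst₂)

private
  variable
    A : Set
    k m r x y γ : ℕ
    xs ys τ : List A

lookup∷⊆drop : ∀ (xs : List A) (j : Fin (length xs)) {t} → t ≤ toℕ j →
               ys ⊆ drop (suc (toℕ j)) xs → lookup xs j ∷ ys ⊆ drop t xs
lookup∷⊆drop (x ∷ xs) zero    z≤n       ys⊆ = refl ∷ ys⊆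
lookup∷⊆drop (x ∷ xs) (suc j) z≤n       ys⊆ = x ∷ʳ lookup∷⊆drop xs j z≤n ys⊆
lookup∷⊆drop (x ∷ xs) (suc j) (s≤s t≤j) ys⊆ = lookup∷⊆drop xs j t≤j ys⊆

occurrence⊆drop : ∀ t (p : Fin r → Fin (length xs)) → StrictlyIncreasing p →
                  (∀ i → t ≤ toℕ (p i)) → tabulate (lookup xs ∘ p) ⊆ drop t xs
occurrence⊆drop {zero}  t p p↑ t≤p = minimum _
occurrence⊆drop {suc r} {xs = xs} t p p↑ t≤p =
  lookup∷⊆drop xs (p zero) (t≤p zero)
    (occurrence⊆drop {xs = xs} (suc (toℕ (p zero))) (p ∘ suc)
      (λ i j i<j → p↑ (suc i) (suc j) (s≤s i<j))
      (λ i → p↑ zero (suc i) (s≤s z≤n)))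

occurrence⇒⊆ : (p : Fin r → Fin (length xs)) → StrictlyIncreasing p → tabulate (lookup xs ∘ p) ⊆ xs
occurrence⇒⊆ p p↑ = occurrence⊆drop 0 p p↑ (λ _ → z≤n)

zero∷suc-strictlyIncreasing : {p : Fin r → Fin m} → StrictlyIncreasing p →
                              StrictlyIncreasing {suc r} (zero Vector.∷ suc ∘ p)
zero∷suc-strictlyIncreasing p↑ zero    (suc j) _         = s≤s z≤n
zero∷suc-strictlyIncreasing p↑ (suc i) (suc j) (s≤s i<j) = s≤s (p↑ i j i<j)

⊆⇒occurrence : (w : Fin r → A) → tabulate w ⊆ xs →
               Σ (Fin r → Fin (length xs)) λ p → StrictlyIncreasing p × (∀ i → lookup xs (p i) ≡ w i)
⊆⇒occurrence {zero}  w _ = (λ ()) , (λ ()) , (λ ())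
⊆⇒occurrence {suc r} w (_ ∷ʳ w⊆) =
  let p , p↑ , p≗ = ⊆⇒occurrence w w⊆
  in  suc ∘ p , (λ i j i<j → s≤s (p↑ i j i<j)) , p≗
⊆⇒occurrence {suc r} w (w₀≡x ∷ w⊆) =
  let p , p↑ , p≗ = ⊆⇒occurrence (w ∘ suc) w⊆
  in  zero Vector.∷ suc ∘ p , zero∷suc-strictlyIncreasing p↑ , λ { zero → sym w₀≡x ; (suc i) → p≗ i }

tabulate-↑ : ∀ m {n} (w : Fin (m + n) → A) →
             tabulate w ≡ tabulate (w ∘ (_↑ˡ n)) ++ tabulate (w ∘ (m ↑ʳ_))
tabulate-↑ zero    w = refl
tabulate-↑ (suc m) w = cong (w zero ∷_) (tabulate-↑ m (w ∘ suc))

module _ {k : ℕ} {σ : List ℕ} (R : (Fin k → ℕ) → ℕ → ℕ → Set) where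

  containsRooted⇒⊆ : ContainsRooted k σ R →
                     ∃₂ λ (bs : Fin k → ℕ) c → Σ ℕ λ a → R bs c a × tabulate bs ++ c ∷ a ∷ [] ⊆ σ
  containsRooted⇒⊆ (p , p↑ , Rw) =
    _ , _ , _ , Rw , subst (_⊆ σ) (tabulate-↑ k (lookup σ ∘ p)) (occurrence⇒⊆ p p↑)

  ⊆⇒containsRooted : ∀ {as c a} → tabulate as ++ c ∷ a ∷ [] ⊆ σ →
                     (∀ {bs} → bs ≗ as → R bs c a) → ContainsRooted k σ R
  ⊆⇒containsRooted {as} {c} {a} occ R-resp =
    let p , p↑ , p≗ = ⊆⇒occurrence w (subst (_⊆ σ) (sym tabulate-w) occ)
    in  p , p↑ , subst₂ (R _) (sym (trans (p≗ _) (lookup-++ʳ as ca zero)))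
                              (sym (trans (p≗ _) (lookup-++ʳ as ca (suc zero))))
                              (R-resp λ i → trans (p≗ _) (lookup-++ˡ as ca i))
    where
    ca : Fin 2 → ℕ
    ca = c Vector.∷ a Vector.∷ Vector.[]
    w : Fin (k + 2) → ℕ
    w = as Vector.++ ca
    tabulate-w : tabulate w ≡ tabulate as ++ c ∷ a ∷ []
    tabulate-w = trans (tabulate-↑ k w)
      (cong₂ _++_ (tabulate-cong (lookup-++ˡ as ca)) (tabulate-cong (lookup-++ʳ as ca)))

DescentAcross : ℕ → List ℕ → Set
DescentAcross t ρ = ∃₂ λ x y → x ∷ y ∷ [] ⊆ ρ × t < x × y ≤ t

SplitsAt : ℕ → List ℕ → Set
SplitsAt t ρ = ∃₂ λ β δ → ρ ≡ β ++ δ × All (_≤ t) β × All (t <_) δ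

descentAcross⊎splitsAt : ∀ t ρ → DescentAcross t ρ ⊎ SplitsAt t ρ
descentAcross⊎splitsAt t [] = inj₂ ([] , [] , refl , [] , [])
descentAcross⊎splitsAt t (x ∷ ρ) with descentAcross⊎splitsAt t ρ | x ≤? t
... | inj₁ (u , v , uv⊆ , t<u , v≤t) | _ = inj₁ (u , v , x ∷ʳ uv⊆ , t<u , v≤t)
... | inj₂ (β , δ , refl , β≤ , δ>) | yes x≤t = inj₂ (x ∷ β , δ , refl , x≤t ∷ β≤ , δ>)
... | inj₂ ([] , δ , refl , [] , δ>) | no x≰t = inj₂ ([] , x ∷ δ , refl , [] , ≰⇒> x≰t ∷ δ>)
... | inj₂ (b ∷ β , δ , refl , b≤t ∷ _ , _) | no x≰t =
  inj₁ (x , b , refl ∷ refl ∷ minimum _ , ≰⇒> x≰t , b≤t)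

¬descentAcross-++ : ∀ {t β δ} → All (_≤ t) β → All (t <_) δ → ¬ DescentAcross t (β ++ δ)
¬descentAcross-++ {β = []} _ δ> (_ , _ , xy⊆ , _ , y≤t) with All-resp-⊆ xy⊆ δ>
... | _ ∷ t<y ∷ [] = <⇒≱ t<y y≤t
¬descentAcross-++ {β = _ ∷ _} (_ ∷ β≤) δ> (x , y , _ ∷ʳ xy⊆ , t<x , y≤t) =
  ¬descentAcross-++ β≤ δ> (x , y , xy⊆ , t<x , y≤t)
¬descentAcross-++ {β = _ ∷ _} (b≤t ∷ _) _ (_ , _ , refl ∷ _ , t<b , _) = <⇒≱ t<b b≤t

kRootedCut⇒¬descent : IsKRootedCut k m τ γ → (bs : Fin k → ℕ) →
                      tabulate bs ++ x ∷ y ∷ [] ⊆ τ → γ < x → ¬ y ≤ γ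
kRootedCut⇒¬descent {x = x} {y} (_ , _ , α , β , δ , refl , |α|≡k , β≤ , δ>) bs occ γ<x y≤γ =
  ¬descentAcross-++ β≤ δ> (_ , _ , xy⊆ , γ<x , y≤γ)
  where
  xy⊆ : x ∷ y ∷ [] ⊆ β ++ δ
  xy⊆ = ++⁻ {as = tabulate bs} {bs = α} (trans (length-tabulate bs) (sym |α|≡k)) occ

InInterval : ℕ → ℕ → Pred ℕ 0ℓ
InInterval a b x = a ≤ x × x ≤ b

inInterval? : ∀ a b → Decidable (InInterval a b)
inInterval? a b x = (a ≤? x) ×-dec (x ≤? b)

rebase : ℕ → ℕ → ℕ
rebase a x = suc (x ∸ a)

All⇒⊆-filter : ∀ {P : Pred A 0ℓ} (P? : Decidable P) → All P xs → xs ⊆ ys → xs ⊆ filter P? ys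
All⇒⊆-filter {ys = ys} P? Pxs xs⊆ys =
  subst (_⊆ filter P? ys) (filter-all P? Pxs) (filter⁺ P? P? (λ { refl Px → Px }) xs⊆ys)

⊆-restrictInterval : ∀ {a b σ} {xs : List ℕ} → All (InInterval a b) xs → xs ⊆ σ →
                     map (rebase a) xs ⊆ restrictInterval a b σ
⊆-restrictInterval {a} {b} xs∈ xs⊆σ = map⁺ (rebase a) (All⇒⊆-filter (inInterval? a b) xs∈ xs⊆σ)

splitsAt⇒kRootedCut : ∀ {a b t σ ρ} (as : Fin k → ℕ) → a ≤ t → t < b →
                      filter (inInterval? a b) σ ≡ tabulate as ++ ρ → SplitsAt t ρ →
                      IsKRootedCut k (suc (b ∸ a)) (restrictInterval a b σ) (rebase a t)
splitsAt⇒kRootedCut {a = a} as a≤t t<b φ≡ (β , δ , refl , β≤ , δ>) =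
  s≤s z≤n , s≤s (∸-monoˡ-< t<b a≤t) ,
  map (rebase a) (tabulate as) , map (rebase a) β , map (rebase a) δ ,
  trans (cong (map (rebase a)) φ≡)
    (trans (map-++ (rebase a) (tabulate as) _)
           (cong (map (rebase a) (tabulate as) ++_) (map-++ (rebase a) β δ))) ,
  trans (length-map (rebase a) (tabulate as)) (length-tabulate as) ,
  Allₚ.map⁺ (All.map (λ x≤t → s≤s (∸-monoˡ-≤ a x≤t)) β≤) ,
  Allₚ.map⁺ (All.map (λ t<x → s≤s (∸-monoˡ-< t<x a≤t)) δ>)

Sandwiched : ∀ k → (Fin k → ℕ) → ℕ → ℕ → Set
Sandwiched k bs c a = ∀ i → InInterval a c (bs i)

kPerm-copies≤k : ∀ {n σ a} {xs : List ℕ} → IsKPerm k n σ → 1 ≤ a → a ≤ n →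
                 All (_≡ a) xs → xs ⊆ σ → length xs ≤ k
kPerm-copies≤k {a = a} (_ , count) 1≤a a≤n xs≡a xs⊆σ =
  subst (_ ≤_) (count a 1≤a a≤n) (length-mono-≤ (All⇒⊆-filter (_≟ a) xs≡a xs⊆σ))

sandwichedRoots⇒¬kRootedCut : ∀ {a c σ} {bs : Fin k → ℕ} → a ≤ c → Sandwiched k bs c a →
                              tabulate bs ++ c ∷ a ∷ [] ⊆ σ →
                              ¬ IsKRootedCut k (suc (c ∸ a)) (restrictInterval a c σ) γ
sandwichedRoots⇒¬kRootedCut {γ = γ} {a} {c} {σ} {bs} a≤c bs∈ occ cut@(1≤γ , γ<c′ , _) =
  kRootedCut⇒¬descent cut (rebase a ∘ bs) occ′ γ<c′ (subst (λ z → suc z ≤ γ) (sym (n∸n≡0 a)) 1≤γ)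
  where
  occ′ : tabulate (rebase a ∘ bs) ++ rebase a c ∷ rebase a a ∷ [] ⊆ restrictInterval a c σ
  occ′ = subst (_⊆ _)
           (trans (map-++ (rebase a) (tabulate bs) _) (cong (_++ _) (map-tabulate bs (rebase a))))
           (⊆-restrictInterval (Allₚ.++⁺ (Allₚ.tabulate⁺ bs∈) ((a≤c , ≤-refl) ∷ (≤-refl , a≤c) ∷ [])) occ)


fully⇒¬sandwichedRoots : ∀ {n σ} → 1 ≤ k → IsKPerm k n σ → FullyKRootedCuttable k n σ →
                         ¬ ContainsRooted k σ (Sandwiched k)
fully⇒¬sandwichedRoots {k} 1≤k perm@(bounds , _) fully pat
  with bs , c , a , bs∈ , occ ← containsRooted⇒⊆ (Sandwiched k) pat
  with (_ , c≤n) ∷ (1≤a , a≤n) ∷ [] ← Allₚ.++⁻ʳ (tabulate bs) (All-resp-⊆ occ bounds)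
  with a≤b₀ , b₀≤c ← bs∈ (fromℕ< 1≤k)
  with m≤n⇒m<n∨m≡n (≤-trans a≤b₀ b₀≤c)
... | inj₁ a<c = sandwichedRoots⇒¬kRootedCut (<⇒≤ a<c) bs∈ occ (fully a c 1≤a a<c c≤n .proj₂)
... | inj₂ refl = m+1+n≰m k (subst (_≤ k) k+2≡ (kPerm-copies≤k perm 1≤a a≤n copies occ))
  where
  copies : All (_≡ a) (tabulate bs ++ a ∷ a ∷ [])
  copies = Allₚ.++⁺ (Allₚ.tabulate⁺ λ i → ≤-antisym (bs∈ i .proj₂) (bs∈ i .proj₁)) (refl ∷ refl ∷ [])
  k+2≡ : length (tabulate bs ++ a ∷ a ∷ []) ≡ k + 2
  k+2≡ = trans (length-++ (tabulate bs)) (cong (_+ 2) (length-tabulate bs))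

DescentAboveRoots : ∀ k → (Fin k → ℕ) → ℕ → ℕ → Set
DescentAboveRoots k as b a = a < b × (∀ i → as i ≤ b)

DescentBelowRoots : ∀ k → (Fin k → ℕ) → ℕ → ℕ → Set
DescentBelowRoots k bs b a = a < b × (∀ i → a ≤ bs i)

BothDescents : ℕ → List ℕ → Set
BothDescents k σ = ContainsRooted k σ (DescentAboveRoots k) × ContainsRooted k σ (DescentBelowRoots k)

tabulate-prefix : ∀ k (xs : List A) → k ≤ length xs → ∃₂ λ (as : Fin k → A) ρ → xs ≡ tabulate as ++ ρ
tabulate-prefix zero    xs       _         = (λ ()) , xs , refl
tabulate-prefix (suc k) (x ∷ xs) (s≤s k≤n) =
  let as , ρ , xs≡ = tabulate-prefix k xs k≤n in x Vector.∷ as , ρ , cong (x ∷_) xs≡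

kPerm-k≤|interval| : ∀ {n σ a b} → IsKPerm k n σ → 1 ≤ a → a ≤ b → b ≤ n →
                     k ≤ length (filter (inInterval? a b) σ)
kPerm-k≤|interval| {σ = σ} {a} {b} (_ , count) 1≤a a≤b b≤n =
  subst (_≤ _) (count a 1≤a (≤-trans a≤b b≤n))
    (length-mono-≤ (filter⁺ (_≟ a) (inInterval? a b) (λ { refl refl → ≤-refl , a≤b }) (⊆-refl {x = σ})))

interval-kRootedCuttable⊎bothDescents : ∀ {n σ a b} → IsKPerm k n σ → 1 ≤ a → a < b → b ≤ n →
  KRootedCuttable k (suc (b ∸ a)) (restrictInterval a b σ) ⊎ BothDescents k σ
interval-kRootedCuttable⊎bothDescents {k} {σ = σ} {a} {suc b′} perm 1≤a a<b b≤n
  with as , ρ , φ≡ ← tabulate-prefix k _ (kPerm-k≤|interval| {σ = σ} perm 1≤a (<⇒≤ a<b) b≤n)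
  with descentAcross⊎splitsAt b′ ρ | descentAcross⊎splitsAt a ρ
... | inj₂ split | _ = inj₁ (_ , splitsAt⇒kRootedCut {σ = σ} as (s≤s⁻¹ a<b) ≤-refl φ≡ split)
... | inj₁ _ | inj₂ split = inj₁ (_ , splitsAt⇒kRootedCut {σ = σ} as ≤-refl a<b φ≡ split)
... | inj₁ (x , y , xy⊆ , b′<x , y≤b′) | inj₁ (x′ , y′ , xy⊆′ , a<x′ , y′≤a) =
  inj₂ ( ⊆⇒containsRooted (DescentAboveRoots k) (occurrence xy⊆)
           (λ bs≗as → <-≤-trans (s≤s y≤b′) b′<x ,
                      λ i → subst (_≤ x) (sym (bs≗as i)) (≤-trans (proj₂ (as∈ i)) b′<x))
       , ⊆⇒containsRooted (DescentBelowRoots k) (occurrence xy⊆′)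
           (λ bs≗as → <-≤-trans (s≤s y′≤a) a<x′ ,
                      λ i → subst (y′ ≤_) (sym (bs≗as i)) (≤-trans y′≤a (proj₁ (as∈ i)))))
  where
  as∈ : ∀ i → InInterval a (suc b′) (as i)
  as∈ = Allₚ.tabulate⁻ (Allₚ.++⁻ˡ (tabulate as) (subst (All _) φ≡ (Allₚ.all-filter (inInterval? a (suc b′)) σ)))
  occurrence : ∀ {x y} → x ∷ y ∷ [] ⊆ ρ → tabulate as ++ x ∷ y ∷ [] ⊆ σ
  occurrence xy⊆ = ⊆-trans (subst (_ ⊆_) (sym φ≡) (++⁺ ⊆-refl xy⊆)) (filter-⊆ _ σ)

bounded-∀⊎ : ∀ {P : ℕ → Set} {Q : Set} N → (∀ x → x < N → P x ⊎ Q) → (∀ x → x < N → P x) ⊎ Q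
bounded-∀⊎ zero    _ = inj₁ λ _ ()
bounded-∀⊎ (suc N) P⊎Q with bounded-∀⊎ N (λ x x<N → P⊎Q x (m<n⇒m<1+n x<N)) | P⊎Q N ≤-refl
... | inj₂ q   | _       = inj₂ q
... | inj₁ _   | inj₂ q  = inj₂ q
... | inj₁ P<N | inj₁ PN = inj₁ λ x x<1+N → [ P<N x , (λ { refl → PN }) ]′ (m<1+n⇒m<n∨m≡n x<1+N)

kPerm⇒fully⊎bothDescents : ∀ {n σ} → IsKPerm k n σ → FullyKRootedCuttable k n σ ⊎ BothDescents k σ
kPerm⇒fully⊎bothDescents {k} {n} {σ} perm =
  map₁ (λ cuttable a b 1≤a a<b b≤n → cuttable a (s≤s (≤-trans (<⇒≤ a<b) b≤n)) b (s≤s b≤n) 1≤a a<b b≤n)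
       (bounded-∀⊎ (suc n) λ a _ → bounded-∀⊎ (suc n) λ b _ → interval a b)
  where
  interval : ∀ a b → (1 ≤ a → a < b → b ≤ n → KRootedCuttable k (suc (b ∸ a)) (restrictInterval a b σ))
                     ⊎ BothDescents k σ
  interval a b with (1 ≤? a) ×-dec (a <? b) ×-dec (b ≤? n)
  ... | yes (1≤a , a<b , b≤n) =
    map₁ (λ cuttable _ _ _ → cuttable) (interval-kRootedCuttable⊎bothDescents perm 1≤a a<b b≤n)
  ... | no ¬bounds = inj₁ λ 1≤a a<b b≤n → ⊥-elim (¬bounds (1≤a , a<b , b≤n))

proposition5p37 : ∀ (k n : ℕ) (σ : List ℕ) → 1 ≤ k → IsKPerm k n σ →
    (FullyKRootedCuttable k n σ →
      ¬ ContainsRooted k σ (λ bs c a → ∀ (i : Fin k) → a ≤ bs i × bs i ≤ c))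
  × (¬ FullyKRootedCuttable k n σ →
      ContainsRooted k σ (λ as b a → a < b × (∀ (i : Fin k) → as i ≤ b))
      × ContainsRooted k σ (λ bs b a → a < b × (∀ (i : Fin k) → a ≤ bs i)))
proposition5p37 k n σ 1≤k perm =
    fully⇒¬sandwichedRoots 1≤k perm
  , λ ¬fully → [ ⊥-elim ∘ ¬fully , id ]′ (kPerm⇒fully⊎bothDescents perm)
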